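{- Let $l$ be a positive integer and let $C_l(n)=\frac{1}{(n+1)^l}\cdot\frac{((l+1)n)!}{(n!)^{l+1}}$ for integers $n\geq 1$. There are at most finitely many integers $n\geq 1$ such that $C_l(n)$ is not an integer. Moreover, every such $n$ is of the form $n=p^j-1$ for some prime $p$ and integer $j\geq 1$ with $p^j\leq l$ and such that $l\neq ap^{kj}-1$ for every integer $k\geq 1$ and every $a\in\{1,2,\ldots,p-1\}$. -}

module Defs where

open import Data.Nat using (ℕ; suc; _+_; _*_; _^_; _!)
open import Data.Nat.Divisibility using (_∣_)


-- C_l(n) = ((l+1)n)! / ((n+1)^l (n!)^(l+1)) is an integer
-- iff the denominator divides the numerator (the denominator is positive).
CIsInteger : ℕ → ℕ → Set
CIsInteger l n = ((n + 1) ^ l) * ((n !) ^ (l + 1)) ∣ ((l + 1) * n) !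

module Submission where

-- Fix a prime p, write v for the p-adic valuation and n + 1 = p^e m with p ∤ m. By Legendre's formula
-- v(((l + 1) n)!) − (l + 1) v(n !) = ∑_{t ≥ 1} ε_t with ε_t = ⌊(l + 1) (n mod p^t) / p^t⌋, so C_l(n) is
-- p-integral as soon as ∑ ε_t ≥ e l = v((n + 1)^l). For t ≤ e we have p^t ∣ n + 1, hence
-- ε_t = l − ⌊l / p^t⌋, and the deficit ⌊l / p^t⌋ is made up by later terms: by ε_{t+e+s} if m > 1 and
-- p^s < m < p^(s+1), by ε_{t+e} if p^e > l, and by ε_{t+e} + ⋯ + ε_{t+ke} (a telescoping geometric sum)
-- if l + 1 = a p^(ke) with 1 ≤ a < p. Since integrality fails only if some prime power divides the
-- denominator but not the numerator, every exceptional n satisfies n + 1 = p^e ≤ l and avoids the last case.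

open import Defs
open import Data.Nat
open import Data.Nat.Properties
open import Data.Nat.DivMod
open import Data.Nat.Divisibility
open import Data.Nat.Primality
open import Data.Nat.Primality.Factorisation using (factorise)
open import Data.Nat.Induction using (<-rec)
open import Data.Nat.ListAction using (product)
open import Data.Nat.Tactic.RingSolver using (solve-∀)
open import Data.List using (_∷_; [])
open import Data.List.Relation.Unary.All using (_∷_)
open import Data.Product using (_×_; ∃-syntax; _,_)
open import Data.Sum using (_⊎_; inj₁; inj₂)
open import Data.Empty using (⊥-elim)
open import Relation.Nullary using (¬_; yes; no)
open import Relation.Binary.PropositionalEquality

-- Finite sums

∑ : (ℕ → ℕ) → ℕ → ℕ → ℕ
∑ f a zero    = 0
∑ f a (suc n) = f a + ∑ f (suc a) n

∑-++ : ∀ f a m n → ∑ f a (m + n) ≡ ∑ f a m + ∑ f (a + m) n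
∑-++ f a zero    n = cong (λ b → ∑ f b n) (sym (+-identityʳ a))
∑-++ f a (suc m) n = begin
  f a + ∑ f (suc a) (m + n)                      ≡⟨ cong (f a +_) (∑-++ f (suc a) m n) ⟩
  f a + (∑ f (suc a) m + ∑ f (suc a + m) n)      ≡⟨ +-assoc (f a) _ _ ⟨
  f a + ∑ f (suc a) m + ∑ f (suc a + m) n        ≡⟨ cong (λ b → f a + ∑ f (suc a) m + ∑ f b n) (+-suc a m) ⟨
  f a + ∑ f (suc a) m + ∑ f (a + suc m) n        ∎
  where open ≡-Reasoning

∑-splitAt : ∀ f a {m n} → m ≤ n → ∑ f a n ≡ ∑ f a m + ∑ f (a + m) (n ∸ m)
∑-splitAt f a {m} {n} m≤n = trans (cong (∑ f a) (sym (m+[n∸m]≡n m≤n))) (∑-++ f a m (n ∸ m))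

∑-snoc : ∀ f a n → ∑ f a (suc n) ≡ ∑ f a n + f (a + n)
∑-snoc f a n = begin
  ∑ f a (suc n)                ≡⟨ cong (∑ f a) (+-comm 1 n) ⟩
  ∑ f a (n + 1)                ≡⟨ ∑-++ f a n 1 ⟩
  ∑ f a n + (f (a + n) + 0)    ≡⟨ cong (∑ f a n +_) (+-identityʳ _) ⟩
  ∑ f a n + f (a + n)          ∎
  where open ≡-Reasoning

∑-cong : ∀ {f g} a n → (∀ i → a ≤ i → i < a + n → f i ≡ g i) → ∑ f a n ≡ ∑ g a n
∑-cong a zero    _  = refl
∑-cong a (suc n) eq = cong₂ _+_ (eq a ≤-refl (m<m+n a z<s))
  (∑-cong (suc a) n λ i a<i i<a+n → eq i (<⇒≤ a<i) (≤-trans i<a+n (≤-reflexive (sym (+-suc a n)))))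

∑-mono-≤ : ∀ {f g} a n → (∀ i → a ≤ i → i < a + n → f i ≤ g i) → ∑ f a n ≤ ∑ g a n
∑-mono-≤ a zero    _  = z≤n
∑-mono-≤ a (suc n) le = +-mono-≤ (le a ≤-refl (m<m+n a z<s))
  (∑-mono-≤ (suc a) n λ i a<i i<a+n → le i (<⇒≤ a<i) (≤-trans i<a+n (≤-reflexive (sym (+-suc a n)))))

∑-monoʳ-≤ : ∀ f a {m n} → m ≤ n → ∑ f a m ≤ ∑ f a n
∑-monoʳ-≤ f a {m} {n} m≤n = begin
  ∑ f a m                          ≤⟨ m≤m+n _ _ ⟩
  ∑ f a m + ∑ f (a + m) (n ∸ m)    ≡⟨ ∑-++ f a m (n ∸ m) ⟨
  ∑ f a (m + (n ∸ m))              ≡⟨ cong (∑ f a) (m+[n∸m]≡n m≤n) ⟩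
  ∑ f a n                          ∎
  where open ≤-Reasoning

∑-const : ∀ c a n → ∑ (λ _ → c) a n ≡ n * c
∑-const c a zero    = refl
∑-const c a (suc n) = cong (c +_) (∑-const c (suc a) n)

∑-distrib-+ : ∀ f g a n → ∑ (λ i → f i + g i) a n ≡ ∑ f a n + ∑ g a n
∑-distrib-+ f g a zero    = refl
∑-distrib-+ f g a (suc n) = begin
  f a + g a + ∑ (λ i → f i + g i) (suc a) n          ≡⟨ cong (f a + g a +_) (∑-distrib-+ f g (suc a) n) ⟩
  f a + g a + (∑ f (suc a) n + ∑ g (suc a) n)        ≡⟨ interchange (f a) (g a) _ _ ⟩
  f a + ∑ f (suc a) n + (g a + ∑ g (suc a) n)        ∎
  where
  open ≡-Reasoning
  interchange : ∀ w x y z → w + x + (y + z) ≡ w + y + (x + z)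
  interchange = solve-∀

∑-distribˡ-* : ∀ c f a n → ∑ (λ i → c * f i) a n ≡ c * ∑ f a n
∑-distribˡ-* c f a zero    = sym (*-zeroʳ c)
∑-distribˡ-* c f a (suc n) = trans (cong (c * f a +_) (∑-distribˡ-* c f (suc a) n)) (sym (*-distribˡ-+ c (f a) _))

∑-shift : ∀ f c a n → ∑ f (c + a) n ≡ ∑ (λ i → f (c + i)) a n
∑-shift f c a zero    = refl
∑-shift f c a (suc n) = cong (f (c + a) +_) (trans (cong (λ b → ∑ f b n) (sym (+-suc c a))) (∑-shift f c (suc a) n))

∑-disjoint-≤ : ∀ f a {m d} n → m ≤ d → ∑ f a m + ∑ f (d + a) n ≤ ∑ f a (d + n)
∑-disjoint-≤ f a {m} {d} n m≤d = begin
  ∑ f a m + ∑ f (d + a) n     ≤⟨ +-monoˡ-≤ _ (∑-monoʳ-≤ f a m≤d) ⟩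
  ∑ f a d + ∑ f (d + a) n     ≡⟨ cong (λ b → ∑ f a d + ∑ f b n) (+-comm d a) ⟩
  ∑ f a d + ∑ f (a + d) n     ≡⟨ ∑-++ f a d n ⟨
  ∑ f a (d + n)               ∎
  where open ≤-Reasoning

∑-pairs-≥ : ∀ f c {e d B} → e ≤ d → d + e ≤ B →
            (∀ t → 1 ≤ t → t ≤ e → c ≤ f t + f (d + t)) → e * c ≤ ∑ f 1 B
∑-pairs-≥ f c {e} {d} {B} e≤d d+e≤B pair = begin
  e * c                                        ≡⟨ ∑-const c 1 e ⟨
  ∑ (λ _ → c) 1 e                              ≤⟨ ∑-mono-≤ 1 e (λ t 1≤t t<1+e → pair t 1≤t (≤-pred t<1+e)) ⟩
  ∑ (λ t → f t + f (d + t)) 1 e                ≡⟨ ∑-distrib-+ f _ 1 e ⟩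
  ∑ f 1 e + ∑ (λ t → f (d + t)) 1 e            ≡⟨ cong (∑ f 1 e +_) (∑-shift f d 1 e) ⟨
  ∑ f 1 e + ∑ f (d + 1) e                      ≤⟨ ∑-disjoint-≤ f 1 e e≤d ⟩
  ∑ f 1 (d + e)                                ≤⟨ ∑-monoʳ-≤ f 1 d+e≤B ⟩
  ∑ f 1 B                                      ∎
  where open ≤-Reasoning

∑-columns : ∀ f e k → ∑ f 1 (k * e) ≡ ∑ (λ t → ∑ (λ j → f (j * e + t)) 0 k) 1 e
∑-columns f e zero    = sym (trans (∑-const 0 1 e) (*-zeroʳ e))
∑-columns f e (suc k) = begin
  ∑ f 1 (e + k * e)                                                   ≡⟨ cong (∑ f 1) (+-comm e (k * e)) ⟩
  ∑ f 1 (k * e + e)                                                   ≡⟨ ∑-++ f 1 (k * e) e ⟩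
  ∑ f 1 (k * e) + ∑ f (suc (k * e)) e                                 ≡⟨ cong₂ _+_ (∑-columns f e k) lastColumn ⟩
  ∑ (λ t → ∑ (λ j → f (j * e + t)) 0 k) 1 e + ∑ (λ t → f (k * e + t)) 1 e  ≡⟨ ∑-distrib-+ _ _ 1 e ⟨
  ∑ (λ t → ∑ (λ j → f (j * e + t)) 0 k + f (k * e + t)) 1 e            ≡⟨ ∑-cong 1 e (λ t _ _ → ∑-snoc (λ j → f (j * e + t)) 0 k) ⟨
  ∑ (λ t → ∑ (λ j → f (j * e + t)) 0 (suc k)) 1 e                     ∎
  where
  open ≡-Reasoning
  lastColumn : ∑ f (suc (k * e)) e ≡ ∑ (λ t → f (k * e + t)) 1 e
  lastColumn = trans (cong (λ b → ∑ f b e) (+-comm 1 (k * e))) (∑-shift f (k * e) 1 e)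

-- Floor division

m≡q*d+r⇒m/d≡q : ∀ {m d q r} .{{_ : NonZero d}} → m ≡ q * d + r → r < d → m / d ≡ q
m≡q*d+r⇒m/d≡q {m} {d} {q} {r} refl r<d = begin
  (q * d + r) / d      ≡⟨ /-congˡ (+-comm (q * d) r) ⟩
  (r + q * d) / d      ≡⟨ +-distrib-/-∣ʳ r (n∣m*n q) ⟩
  r / d + q * d / d    ≡⟨ cong₂ _+_ (m<n⇒m/n≡0 r<d) (m*n/n≡m q d) ⟩
  q                    ∎
  where open ≡-Reasoning

m≡q*d+r⇒m%d≡r : ∀ {m d q r} .{{_ : NonZero d}} → m ≡ q * d + r → r < d → m % d ≡ r
m≡q*d+r⇒m%d≡r {q = q} {r} refl r<d =
  trans (%-congˡ (+-comm (q * _) r)) (trans ([m+kn]%n≡m%n r q _) (m<n⇒m%n≡m r<d))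

suc[m/d]≡w : ∀ {m a d w} .{{_ : NonZero d}} → 1 ≤ a → a ≤ d → m + a ≡ d * w → suc (m / d) ≡ w
suc[m/d]≡w {m} {a} {d} {zero}  1≤a _   eq = ⊥-elim (<⇒≢ (≤-trans 1≤a (m≤n+m a m)) (sym (trans eq (*-zeroʳ d))))
suc[m/d]≡w {m} {a} {d} {suc w} 1≤a a≤d eq = cong suc (m≡q*d+r⇒m/d≡q m≡w*d+[d∸a] (∸-monoʳ-< 1≤a a≤d))
  where
  m≡w*d+[d∸a] : m ≡ w * d + (d ∸ a)
  m≡w*d+[d∸a] = +-cancelʳ-≡ a m _ (begin
    m + a                  ≡⟨ eq ⟩
    d * suc w              ≡⟨ trans (*-comm d (suc w)) (+-comm d (w * d)) ⟩
    w * d + d              ≡⟨ cong (w * d +_) (m∸n+n≡m a≤d) ⟨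
    w * d + (d ∸ a + a)    ≡⟨ +-assoc (w * d) (d ∸ a) a ⟨
    w * d + (d ∸ a) + a    ∎)
    where open ≡-Reasoning

suc[m]/d≡suc[m/d] : ∀ {m d} .{{_ : NonZero d}} → d ∣ suc m → suc m / d ≡ suc (m / d)
suc[m]/d≡suc[m/d] {m} {d} d∣1+m = trans (n/m≡quotient d∣1+m)
  (sym (suc[m/d]≡w {a = 1} ≤-refl (>-nonZero⁻¹ d) (trans (+-comm m 1) (m∣n⇒n≡m*quotient d∣1+m))))

suc[m]/d≡m/d : ∀ {m d} .{{_ : NonZero d}} → ¬ d ∣ suc m → suc m / d ≡ m / d
suc[m]/d≡m/d {m} {d} d∤1+m with suc (m % d) ≟ d
... | yes 1+m%d≡d = ⊥-elim (d∤1+m (divides (suc (m / d)) (begin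
  suc m                        ≡⟨ cong suc (m≡m%n+[m/n]*n m d) ⟩
  suc (m % d) + m / d * d      ≡⟨ cong (_+ m / d * d) 1+m%d≡d ⟩
  d + m / d * d                ∎)))
  where open ≡-Reasoning
... | no 1+m%d≢d = m≡q*d+r⇒m/d≡q (begin
  suc m                        ≡⟨ cong suc (m≡m%n+[m/n]*n m d) ⟩
  suc (m % d) + m / d * d      ≡⟨ +-comm (suc (m % d)) _ ⟩
  m / d * d + suc (m % d)      ∎) (≤∧≢⇒< (m%n<n m d) 1+m%d≢d)
  where open ≡-Reasoning

[c*m]/d≡c*[m/d]+[c*[m%d]]/d : ∀ c m d .{{_ : NonZero d}} → c * m / d ≡ c * (m / d) + c * (m % d) / d
[c*m]/d≡c*[m/d]+[c*[m%d]]/d c m d = begin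
  c * m / d                                   ≡⟨ /-congˡ (cong (c *_) (m≡m%n+[m/n]*n m d)) ⟩
  c * (m % d + m / d * d) / d                 ≡⟨ /-congˡ (expand c (m % d) (m / d) d) ⟩
  (c * (m % d) + c * (m / d) * d) / d         ≡⟨ +-distrib-/-∣ʳ (c * (m % d)) (n∣m*n (c * (m / d))) ⟩
  c * (m % d) / d + c * (m / d) * d / d       ≡⟨ cong (c * (m % d) / d +_) (m*n/n≡m (c * (m / d)) d) ⟩
  c * (m % d) / d + c * (m / d)               ≡⟨ +-comm (c * (m % d) / d) _ ⟩
  c * (m / d) + c * (m % d) / d               ∎
  where
  open ≡-Reasoning
  expand : ∀ c r q d → c * (r + q * d) ≡ c * r + c * q * d
  expand = solve-∀

-- Writing l = a * q + b and q = 1 + b + c, one has (1 + l) * (q ∸ 1) + a * q = l * q + c with c < q.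
[1+l]*[q∸1]/q+l/q≡l : ∀ l q .{{_ : NonZero q}} → suc l * pred q / q + l / q ≡ l
[1+l]*[q∸1]/q+l/q≡l l q@(suc q') = begin
  suc l * q' / q + a                 ≡⟨ cong (suc l * q' / q +_) (m*n/n≡m a q) ⟨
  suc l * q' / q + a * q / q         ≡⟨ +-distrib-/-∣ʳ (suc l * q') (n∣m*n a) ⟨
  (suc l * q' + a * q) / q           ≡⟨ m≡q*d+r⇒m/d≡q key (s≤s (m∸n≤m q' b)) ⟩
  l                                  ∎
  where
  open ≡-Reasoning
  a = l / q
  b = l % q
  c = q' ∸ b
  identity : ∀ a b c → suc (b + a * suc (b + c)) * (b + c) + a * suc (b + c) ≡ (b + a * suc (b + c)) * suc (b + c) + c
  identity = solve-∀
  l≡b+a*q : l ≡ b + a * q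
  l≡b+a*q = m≡m%n+[m/n]*n l q
  q'≡b+c : q' ≡ b + c
  q'≡b+c = sym (m+[n∸m]≡n (≤-pred (m%n<n l q)))
  key : suc l * q' + a * q ≡ l * q + c
  key = subst (λ l → suc l * q' + a * q ≡ l * q + c) (sym l≡b+a*q)
          (subst (λ q' → suc (b + a * suc q') * q' + a * suc q' ≡ (b + a * suc q') * suc q' + c) (sym q'≡b+c)
            (identity a b c))

d∣suc[m]⇒m%d≡pred[d] : ∀ {m d} .{{_ : NonZero d}} → d ∣ suc m → m % d ≡ pred d
d∣suc[m]⇒m%d≡pred[d] {m} {d@(suc d')} (divides zero ())
d∣suc[m]⇒m%d≡pred[d] {m} {d@(suc d')} (divides (suc k) 1+m≡[1+k]*d) =
  m≡q*d+r⇒m%d≡r {q = k} (suc-injective (trans 1+m≡[1+k]*d (cong suc (+-comm d' (k * d))))) ≤-refl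

m*d≤n⇒m≤n/d : ∀ {m n d} .{{_ : NonZero d}} → m * d ≤ n → m ≤ n / d
m*d≤n⇒m≤n/d {m} {n} {d} m*d≤n = subst (_≤ n / d) (m*n/n≡m m d) (/-monoˡ-≤ d m*d≤n)

b^m∣b^n : ∀ b {m n} → m ≤ n → b ^ m ∣ b ^ n
b^m∣b^n b {m} {n} m≤n = divides (b ^ (n ∸ m)) (trans (cong (b ^_) (sym (m∸n+n≡m m≤n))) (^-distribˡ-+-* b (n ∸ m) m))

∤⇒nonZero : ∀ {d n} → ¬ d ∣ n → NonZero n
∤⇒nonZero {n = zero}  d∤0 = ⊥-elim (d∤0 (_∣0 _))
∤⇒nonZero {n = suc _} _   = _

[m*n]^k≡m^k*n^k : ∀ m n k → (m * n) ^ k ≡ m ^ k * n ^ k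
[m*n]^k≡m^k*n^k m n zero    = refl
[m*n]^k≡m^k*n^k m n (suc k) = trans (cong (m * n *_) ([m*n]^k≡m^k*n^k m n k)) (interchange m n (m ^ k) (n ^ k))
  where
  interchange : ∀ w x y z → w * x * (y * z) ≡ w * y * (x * z)
  interchange = solve-∀

-- Valuations at a prime

Exceptional : ℕ → ℕ → ℕ → Set
Exceptional l n p = ∃[ j ] (1 ≤ j × n ≡ p ^ j ∸ 1 × p ^ j ≤ l
                            × ((k a : ℕ) → 1 ≤ k → 1 ≤ a → a + 1 ≤ p → l ≢ a * p ^ (k * j) ∸ 1))

module _ {p : ℕ} (p-prime : Prime p) where

  private instance
    p≢0 : NonZero p
    p≢0 = prime⇒nonZero p-prime

  1<p : 1 < p
  1<p = nonTrivial⇒n>1 p {{prime⇒nonTrivial p-prime}}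

  n<p^n : ∀ n → n < p ^ n
  n<p^n zero    = z<s
  n<p^n (suc n) = ≤-<-trans (n<p^n n) (^-monoʳ-< p 1<p (n<1+n n))

  p∤1 : ¬ p ∣ 1
  p∤1 p∣1 = nonTrivial⇒≢1 {{prime⇒nonTrivial p-prime}} (∣1⇒≡1 p∣1)

  p∤* : ∀ {m n} → ¬ p ∣ m → ¬ p ∣ n → ¬ p ∣ m * n
  p∤* {m} {n} p∤m p∤n p∣mn with euclidsLemma m n p-prime p∣mn
  ... | inj₁ p∣m = p∤m p∣m
  ... | inj₂ p∣n = p∤n p∣n

  p∤^ : ∀ {m} k → ¬ p ∣ m → ¬ p ∣ m ^ k
  p∤^ zero    _   = p∤1
  p∤^ (suc k) p∤m = p∤* p∤m (p∤^ k p∤m)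

  p^e∣m*r⇒p^e∣m : ∀ {r} e m → ¬ p ∣ r → p ^ e ∣ m * r → p ^ e ∣ m
  p^e∣m*r⇒p^e∣m zero    m _   _ = 1∣ m
  p^e∣m*r⇒p^e∣m {r} (suc e) m p∤r p^[1+e]∣mr with euclidsLemma m r p-prime (∣-trans (m∣m*n (p ^ e)) p^[1+e]∣mr)
  ... | inj₂ p∣r = ⊥-elim (p∤r p∣r)
  ... | inj₁ (divides m' refl) = subst (p ^ suc e ∣_) (*-comm p m')
          (*-monoʳ-∣ p (p^e∣m*r⇒p^e∣m e m' p∤r (*-cancelˡ-∣ p (subst (p * p ^ e ∣_) (reassoc m' p r) p^[1+e]∣mr))))
    where
    reassoc : ∀ x y z → x * y * z ≡ y * (x * z)
    reassoc = solve-∀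

  p^e∣p^a*r⇒e≤a : ∀ {r} e a → ¬ p ∣ r → p ^ e ∣ p ^ a * r → e ≤ a
  p^e∣p^a*r⇒e≤a {r} e a p∤r p^e∣p^ar with e ≤? a
  ... | yes e≤a = e≤a
  ... | no  e≰a = ⊥-elim (p∤r (*-cancelˡ-∣ (p ^ a) {{m^n≢0 p a}}
          (subst (_∣ p ^ a * r) (*-comm p (p ^ a)) (∣-trans (b^m∣b^n p (≰⇒> e≰a)) p^e∣p^ar))))

  factorOut : ∀ m .{{_ : NonZero m}} → ∃[ a ] ∃[ r ] (m ≡ p ^ a * r × ¬ p ∣ r)
  factorOut m = <-rec Factored go m
    where
    Factored : ℕ → Set
    Factored m = .{{NonZero m}} → ∃[ a ] ∃[ r ] (m ≡ p ^ a * r × ¬ p ∣ r)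
    go : ∀ m → (∀ {k} → k < m → Factored k) → Factored m
    go m rec with p ∣? m
    ... | no  p∤m = 0 , m , sym (+-identityʳ m) , p∤m
    ... | yes (divides zero m≡0) = ⊥-elim (≢-nonZero⁻¹ m m≡0)
    ... | yes (divides k@(suc _) refl) with rec (m<m*n k p 1<p)
    ...   | a , r , k≡p^a*r , p∤r = suc a , r , trans (cong (_* p) k≡p^a*r) (reassoc (p ^ a) r p) , p∤r
      where
      reassoc : ∀ x y z → x * y * z ≡ z * x * y
      reassoc = solve-∀

  powerBracket : ∀ {m} S → 1 ≤ m → m < p ^ S → ∃[ s ] (p ^ s ≤ m × m < p ^ suc s)
  powerBracket zero    1≤m m<1 = ⊥-elim (<⇒≱ m<1 1≤m)
  powerBracket {m} (suc S) 1≤m m<p^[1+S] with m <? p ^ S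
  ... | yes m<p^S = powerBracket S 1≤m m<p^S
  ... | no  m≮p^S = S , ≮⇒≥ m≮p^S , m<p^[1+S]

  strictPowerBracket : ∀ {m} → 2 ≤ m → ¬ p ∣ m → ∃[ s ] (p ^ s < m × m < p ^ suc s)
  strictPowerBracket {m} 2≤m p∤m with powerBracket m (<⇒≤ 2≤m) (n<p^n m)
  ... | s , p^s≤m , m<p^[1+s] with m≤n⇒m<n∨m≡n p^s≤m
  ...   | inj₁ p^s<m = s , p^s<m , m<p^[1+s]
  ...   | inj₂ p^s≡m with s
  ...     | zero   = ⊥-elim (<⇒≢ 2≤m p^s≡m)
  ...     | suc s' = ⊥-elim (p∤m (divides (p ^ s') (trans (sym p^s≡m) (*-comm p (p ^ s')))))

  p^≢0 : ∀ t → NonZero (p ^ t)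
  p^≢0 t = m^n≢0 p t

  ⌊_/p^_⌋ : ℕ → ℕ → ℕ
  ⌊ x /p^ t ⌋ = _/_ x (p ^ t) {{p^≢0 t}}

  _%p^_ : ℕ → ℕ → ℕ
  x %p^ t = _%_ x (p ^ t) {{p^≢0 t}}

  p^a*p^b≢0 : ∀ a b → NonZero (p ^ a * p ^ b)
  p^a*p^b≢0 a b = m*n≢0 (p ^ a) (p ^ b) {{p^≢0 a}} {{p^≢0 b}}

  ⌊p^a*m/p^[a+t]⌋≡⌊m/p^t⌋ : ∀ a m t → ⌊ p ^ a * m /p^ (a + t) ⌋ ≡ ⌊ m /p^ t ⌋
  ⌊p^a*m/p^[a+t]⌋≡⌊m/p^t⌋ a m t = trans (/-congʳ {{p^≢0 (a + t)}} {{p^a*p^b≢0 a t}} (^-distribˡ-+-* p a t))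
                                        (m*n/m*o≡n/o (p ^ a) m (p ^ t) {{p^≢0 t}} {{p^a*p^b≢0 a t}})

  ⌊p^t*m/p^t⌋≡m : ∀ t m → ⌊ p ^ t * m /p^ t ⌋ ≡ m
  ⌊p^t*m/p^t⌋≡m t m = trans (/-congˡ {{p^≢0 t}} (*-comm (p ^ t) m)) (m*n/n≡m m (p ^ t) {{p^≢0 t}})

  ⌊⌊m/p^s⌋/p^t⌋≡⌊m/p^[t+s]⌋ : ∀ m s t → ⌊ ⌊ m /p^ s ⌋ /p^ t ⌋ ≡ ⌊ m /p^ (t + s) ⌋
  ⌊⌊m/p^s⌋/p^t⌋≡⌊m/p^[t+s]⌋ m s t = trans (m/n/o≡m/[n*o] m (p ^ s) (p ^ t) {{p^≢0 s}} {{p^≢0 t}} {{p^a*p^b≢0 s t}})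
    (/-congʳ {{p^a*p^b≢0 s t}} {{p^≢0 (t + s)}} (trans (sym (^-distribˡ-+-* p s t)) (cong (p ^_) (+-comm s t))))

  legendreSum : ℕ → ℕ → ℕ
  legendreSum B x = ∑ (λ t → ⌊ x /p^ t ⌋) 1 B

  legendreSum-zero : ∀ B → legendreSum B 0 ≡ 0
  legendreSum-zero B = trans (∑-cong 1 B (λ t _ _ → 0/n≡0 (p ^ t) {{p^≢0 t}})) (trans (∑-const 0 1 B) (*-zeroʳ B))

  -- Exactly the first a terms grow by one when passing from x to x + 1 = p ^ a * r.
  legendreSum-suc : ∀ {B x a r} → suc x ≡ p ^ a * r → ¬ p ∣ r → a ≤ B →
                    legendreSum B (suc x) ≡ a + legendreSum B x
  legendreSum-suc {B} {x} {a} {r} 1+x≡p^a*r p∤r a≤B = begin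
    ∑ (λ t → ⌊ suc x /p^ t ⌋) 1 B                                          ≡⟨ ∑-splitAt _ 1 a≤B ⟩
    ∑ (λ t → ⌊ suc x /p^ t ⌋) 1 a + ∑ (λ t → ⌊ suc x /p^ t ⌋) (suc a) (B ∸ a)  ≡⟨ cong₂ _+_ low high ⟩
    a + ∑ (λ t → ⌊ x /p^ t ⌋) 1 a + ∑ (λ t → ⌊ x /p^ t ⌋) (suc a) (B ∸ a)      ≡⟨ +-assoc a _ _ ⟩
    a + (∑ (λ t → ⌊ x /p^ t ⌋) 1 a + ∑ (λ t → ⌊ x /p^ t ⌋) (suc a) (B ∸ a))    ≡⟨ cong (a +_) (∑-splitAt _ 1 a≤B) ⟨
    a + ∑ (λ t → ⌊ x /p^ t ⌋) 1 B                                          ∎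
    where
    open ≡-Reasoning
    low : ∑ (λ t → ⌊ suc x /p^ t ⌋) 1 a ≡ a + ∑ (λ t → ⌊ x /p^ t ⌋) 1 a
    low = begin
      ∑ (λ t → ⌊ suc x /p^ t ⌋) 1 a                 ≡⟨ ∑-cong 1 a (λ t _ t≤a → suc[m]/d≡suc[m/d] {{p^≢0 t}} (p^t∣1+x (≤-pred t≤a))) ⟩
      ∑ (λ t → 1 + ⌊ x /p^ t ⌋) 1 a                 ≡⟨ ∑-distrib-+ (λ _ → 1) _ 1 a ⟩
      ∑ (λ _ → 1) 1 a + ∑ (λ t → ⌊ x /p^ t ⌋) 1 a   ≡⟨ cong (_+ ∑ (λ t → ⌊ x /p^ t ⌋) 1 a) (trans (∑-const 1 1 a) (*-identityʳ a)) ⟩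
      a + ∑ (λ t → ⌊ x /p^ t ⌋) 1 a                 ∎
      where
      p^t∣1+x : ∀ {t} → t ≤ a → p ^ t ∣ suc x
      p^t∣1+x {t} t≤a = subst (p ^ t ∣_) (sym 1+x≡p^a*r) (∣-trans (b^m∣b^n p t≤a) (m∣m*n r))
    high : ∑ (λ t → ⌊ suc x /p^ t ⌋) (suc a) (B ∸ a) ≡ ∑ (λ t → ⌊ x /p^ t ⌋) (suc a) (B ∸ a)
    high = ∑-cong (suc a) (B ∸ a) λ t a<t _ → suc[m]/d≡m/d {{p^≢0 t}} λ p^t∣1+x → <⇒≱ a<t
      (p^e∣p^a*r⇒e≤a t a p∤r (subst (p ^ t ∣_) 1+x≡p^a*r p^t∣1+x))

  legendre : ∀ {B} x → x ≤ B → ∃[ u ] (x ! ≡ p ^ legendreSum B x * u × ¬ p ∣ u)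
  legendre {B} zero    _     = 1 , cong (λ e → p ^ e * 1) (sym (legendreSum-zero B)) , p∤1
  legendre {B} (suc x) 1+x≤B = step (legendre x (<⇒≤ 1+x≤B)) (factorOut (suc x))
    where
    open ≡-Reasoning
    interchange : ∀ w x y z → w * x * (y * z) ≡ w * y * (x * z)
    interchange = solve-∀
    step : ∃[ u ] (x ! ≡ p ^ legendreSum B x * u × ¬ p ∣ u) → ∃[ a ] ∃[ r ] (suc x ≡ p ^ a * r × ¬ p ∣ r) →
           ∃[ u ] (suc x ! ≡ p ^ legendreSum B (suc x) * u × ¬ p ∣ u)
    step (u , x!≡p^s*u , p∤u) (a , r , 1+x≡p^a*r , p∤r) = r * u , (begin
      suc x * x !                                  ≡⟨ cong₂ _*_ 1+x≡p^a*r x!≡p^s*u ⟩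
      p ^ a * r * (p ^ legendreSum B x * u)        ≡⟨ interchange (p ^ a) r _ u ⟩
      p ^ a * p ^ legendreSum B x * (r * u)        ≡⟨ cong (_* (r * u)) (^-distribˡ-+-* p a _) ⟨
      p ^ (a + legendreSum B x) * (r * u)          ≡⟨ cong (λ e → p ^ e * (r * u)) (legendreSum-suc 1+x≡p^a*r p∤r a≤B) ⟨
      p ^ legendreSum B (suc x) * (r * u)          ∎) , p∤* p∤r p∤u
      where
      a≤B : a ≤ B
      a≤B = ≤-trans (<⇒≤ (n<p^n a)) (≤-trans (m≤m*n (p ^ a) r {{∤⇒nonZero p∤r}}) (≤-trans (≤-reflexive (sym 1+x≡p^a*r)) 1+x≤B))

  -- With q = p ^ e = n + 1 this is ∑_{j=1}^{k+1} ⌊c q^k (q − 1) / q^j⌋ = c q^k − 1, a telescoping geometric sum.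
  geometricFloorSum : ∀ {n e c} → suc n ≡ p ^ e → 1 ≤ c → c ≤ p ^ e → ∀ k →
                      suc (∑ (λ j → ⌊ c * p ^ (k * e) * n /p^ (j * e) ⌋) 1 (suc k)) ≡ c * p ^ (k * e)
  geometricFloorSum {n} {e} {c} 1+n≡p^e 1≤c c≤p^e zero = begin
    suc (⌊ c * 1 * n /p^ (e + 0) ⌋ + 0)     ≡⟨ cong suc (+-identityʳ _) ⟩
    suc (⌊ c * 1 * n /p^ (e + 0) ⌋)         ≡⟨ cong (λ e → suc ⌊ c * 1 * n /p^ e ⌋) (+-identityʳ e) ⟩
    suc (⌊ c * 1 * n /p^ e ⌋)               ≡⟨ suc[m/d]≡w {{p^≢0 e}} 1≤c c≤p^e (begin
      c * 1 * n + c                                ≡⟨ distrib c n ⟩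
      c * 1 * suc n                                ≡⟨ cong (c * 1 *_) 1+n≡p^e ⟩
      c * 1 * p ^ e                                ≡⟨ *-comm (c * 1) (p ^ e) ⟩
      p ^ e * (c * 1)                              ∎) ⟩
    c * 1                                   ∎
    where
    open ≡-Reasoning
    distrib : ∀ c n → c * 1 * n + c ≡ c * 1 * suc n
    distrib = solve-∀
  geometricFloorSum {n} {e} {c} 1+n≡p^e 1≤c c≤p^e (suc k) = begin
    suc (⌊ X /p^ (e + 0) ⌋ + ∑ (λ j → ⌊ X /p^ (j * e) ⌋) 2 (suc k))           ≡⟨ cong₂ (λ x y → suc (x + y)) first rest ⟩
    suc (y + ∑ (λ j → ⌊ y /p^ (j * e) ⌋) 1 (suc k))                            ≡⟨ +-suc y _ ⟨
    y + suc (∑ (λ j → ⌊ y /p^ (j * e) ⌋) 1 (suc k))                            ≡⟨ cong (y +_) (geometricFloorSum 1+n≡p^e 1≤c c≤p^e k) ⟩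
    c * p ^ (k * e) * n + c * p ^ (k * e)                                     ≡⟨ distrib (c * p ^ (k * e)) n ⟩
    c * p ^ (k * e) * suc n                                                   ≡⟨ cong (c * p ^ (k * e) *_) 1+n≡p^e ⟩
    c * p ^ (k * e) * p ^ e                                                   ≡⟨ reassoc c (p ^ (k * e)) (p ^ e) ⟩
    c * (p ^ e * p ^ (k * e))                                                 ≡⟨ cong (c *_) (^-distribˡ-+-* p e (k * e)) ⟨
    c * p ^ (e + k * e)                                                       ∎
    where
    open ≡-Reasoning
    X = c * p ^ (e + k * e) * n
    y = c * p ^ (k * e) * n
    distrib : ∀ x n → x * n + x ≡ x * suc n
    distrib = solve-∀
    reassoc : ∀ c x y → c * x * y ≡ c * (y * x)
    reassoc = solve-∀
    X≡p^e*y : X ≡ p ^ e * y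
    X≡p^e*y = trans (cong (λ z → c * z * n) (^-distribˡ-+-* p e (k * e))) (pull c (p ^ e) (p ^ (k * e)) n)
      where
      pull : ∀ c a b n → c * (a * b) * n ≡ a * (c * b * n)
      pull = solve-∀
    first : ⌊ X /p^ (e + 0) ⌋ ≡ y
    first = trans (cong ⌊_/p^ (e + 0) ⌋ X≡p^e*y) (trans (⌊p^a*m/p^[a+t]⌋≡⌊m/p^t⌋ e y 0) (n/1≡n y))
    rest : ∑ (λ j → ⌊ X /p^ (j * e) ⌋) 2 (suc k) ≡ ∑ (λ j → ⌊ y /p^ (j * e) ⌋) 1 (suc k)
    rest = trans (∑-shift _ 1 1 (suc k)) (∑-cong 1 (suc k) λ j _ _ →
             trans (cong ⌊_/p^ (e + j * e) ⌋ X≡p^e*y) (⌊p^a*m/p^[a+t]⌋≡⌊m/p^t⌋ e y (j * e)))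

  module Excess (l n : ℕ) where

    excess : ℕ → ℕ
    excess t = ⌊ suc l * (n %p^ t) /p^ t ⌋

    legendreSum-scale : ∀ B → legendreSum B (suc l * n) ≡ suc l * legendreSum B n + ∑ excess 1 B
    legendreSum-scale B = begin
      ∑ (λ t → ⌊ suc l * n /p^ t ⌋) 1 B                                   ≡⟨ ∑-cong 1 B (λ t _ _ → [c*m]/d≡c*[m/d]+[c*[m%d]]/d (suc l) n (p ^ t) {{p^≢0 t}}) ⟩
      ∑ (λ t → suc l * ⌊ n /p^ t ⌋ + excess t) 1 B                         ≡⟨ ∑-distrib-+ _ excess 1 B ⟩
      ∑ (λ t → suc l * ⌊ n /p^ t ⌋) 1 B + ∑ excess 1 B                     ≡⟨ cong (_+ ∑ excess 1 B) (∑-distribˡ-* (suc l) _ 1 B) ⟩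
      suc l * legendreSum B n + ∑ excess 1 B                               ∎
      where open ≡-Reasoning

    excess-large : ∀ t → n < p ^ t → excess t ≡ ⌊ suc l * n /p^ t ⌋
    excess-large t n<p^t = cong (λ r → ⌊ suc l * r /p^ t ⌋) (m<n⇒m%n≡m {{p^≢0 t}} n<p^t)

    excess+⌊l/p^t⌋≡l : ∀ t → p ^ t ∣ suc n → excess t + ⌊ l /p^ t ⌋ ≡ l
    excess+⌊l/p^t⌋≡l t p^t∣1+n = trans (cong (λ r → ⌊ suc l * r /p^ t ⌋ + ⌊ l /p^ t ⌋) (d∣suc[m]⇒m%d≡pred[d] {{p^≢0 t}} p^t∣1+n))
                                         ([1+l]*[q∸1]/q+l/q≡l l (p ^ t) {{p^≢0 t}})

    l≤excess+excess : ∀ t d → p ^ t ∣ suc n → n < p ^ (d + t) → l * p ^ d ≤ suc l * n → l ≤ excess t + excess (d + t)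
    l≤excess+excess t d p^t∣1+n n<p^[d+t] l*p^d≤[1+l]*n = begin
      l                                      ≡⟨ excess+⌊l/p^t⌋≡l t p^t∣1+n ⟨
      excess t + ⌊ l /p^ t ⌋                 ≤⟨ +-monoʳ-≤ (excess t) ⌊l/p^t⌋≤excess[d+t] ⟩
      excess t + excess (d + t)              ∎
      where
      open ≤-Reasoning
      ⌊l/p^t⌋≤excess[d+t] : ⌊ l /p^ t ⌋ ≤ excess (d + t)
      ⌊l/p^t⌋≤excess[d+t] = subst (⌊ l /p^ t ⌋ ≤_) (sym (excess-large (d + t) n<p^[d+t])) (m*d≤n⇒m≤n/d {{p^≢0 (d + t)}} (begin
        ⌊ l /p^ t ⌋ * p ^ (d + t)              ≡⟨ cong (⌊ l /p^ t ⌋ *_) (trans (^-distribˡ-+-* p d t) (*-comm (p ^ d) (p ^ t))) ⟩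
        ⌊ l /p^ t ⌋ * (p ^ t * p ^ d)          ≡⟨ *-assoc ⌊ l /p^ t ⌋ (p ^ t) (p ^ d) ⟨
        ⌊ l /p^ t ⌋ * p ^ t * p ^ d            ≤⟨ *-monoˡ-≤ (p ^ d) (m/n*n≤m l (p ^ t) {{p^≢0 t}}) ⟩
        l * p ^ d                              ≤⟨ l*p^d≤[1+l]*n ⟩
        suc l * n                              ∎))

    gap-large : ∀ {e B} → suc n ≡ p ^ e → suc l ≤ p ^ e → e + e ≤ B → e * l ≤ ∑ excess 1 B
    gap-large {e} {B} 1+n≡p^e 1+l≤p^e e+e≤B = ∑-pairs-≥ excess l {e} {e} ≤-refl e+e≤B λ t _ t≤e →
      l≤excess+excess t e (subst (p ^ t ∣_) (sym 1+n≡p^e) (b^m∣b^n p t≤e))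
        (<-≤-trans (≤-reflexive 1+n≡p^e) (^-monoʳ-≤ p (m≤m+n e t))) l*p^e≤[1+l]*n
      where
      l*p^e≤[1+l]*n : l * p ^ e ≤ suc l * n
      l*p^e≤[1+l]*n = +-cancelʳ-≤ (suc l) _ _ (begin
        l * p ^ e + suc l       ≤⟨ +-monoʳ-≤ (l * p ^ e) 1+l≤p^e ⟩
        l * p ^ e + p ^ e       ≡⟨ +-comm (l * p ^ e) (p ^ e) ⟩
        suc l * p ^ e           ≡⟨ cong (suc l *_) 1+n≡p^e ⟨
        suc l * suc n           ≡⟨ *-suc (suc l) n ⟩
        suc l + suc l * n       ≡⟨ +-comm (suc l) (suc l * n) ⟩
        suc l * n + suc l       ∎)
        where open ≤-Reasoning

    gap-notPrimePower : ∀ {e m s B} → suc n ≡ p ^ e * m → p ^ s < m → m < p ^ suc s → (e + s) + e ≤ B →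
                        e * l ≤ ∑ excess 1 B
    gap-notPrimePower {e} {m} {s} {B} 1+n≡p^e*m p^s<m m<p^[1+s] bound =
      ∑-pairs-≥ excess l {e} {e + s} (m≤m+n e s) bound λ t 1≤t t≤e →
        l≤excess+excess t (e + s) (subst (p ^ t ∣_) (sym 1+n≡p^e*m) (∣-trans (b^m∣b^n p t≤e) (m∣m*n m))) (n<p^[e+s+t] 1≤t)
          (*-mono-≤ (n≤1+n l) p^[e+s]≤n)
      where
      open ≤-Reasoning
      p^[e+s]≤n : p ^ (e + s) ≤ n
      p^[e+s]≤n = ≤-pred (begin
        suc (p ^ (e + s))               ≡⟨ cong suc (^-distribˡ-+-* p e s) ⟩
        suc (p ^ e * p ^ s)             ≤⟨ +-monoˡ-≤ (p ^ e * p ^ s) (m^n>0 p e) ⟩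
        p ^ e + p ^ e * p ^ s           ≡⟨ *-suc (p ^ e) (p ^ s) ⟨
        p ^ e * suc (p ^ s)             ≤⟨ *-monoʳ-≤ (p ^ e) p^s<m ⟩
        p ^ e * m                       ≡⟨ 1+n≡p^e*m ⟨
        suc n                           ∎)
      n<p^[e+s+t] : ∀ {t} → 1 ≤ t → n < p ^ ((e + s) + t)
      n<p^[e+s+t] {t} 1≤t = begin-strict
        n                         <⟨ n<1+n n ⟩
        suc n                     ≡⟨ 1+n≡p^e*m ⟩
        p ^ e * m                 ≤⟨ *-monoʳ-≤ (p ^ e) (<⇒≤ m<p^[1+s]) ⟩
        p ^ e * p ^ suc s         ≡⟨ ^-distribˡ-+-* p e (suc s) ⟨
        p ^ (e + suc s)           ≤⟨ ^-monoʳ-≤ p (≤-trans (≤-reflexive (trans (+-suc e s) (+-comm 1 (e + s)))) (+-monoʳ-≤ (e + s) 1≤t)) ⟩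
        p ^ ((e + s) + t)         ∎

    columnSum-special : ∀ {e a k} t → suc n ≡ p ^ e → suc l ≡ a * p ^ (suc k * e) → 1 ≤ a → a < p → 1 ≤ t → t ≤ e →
                        ∑ (λ j → excess (j * e + t)) 0 (suc (suc k)) ≡ l
    columnSum-special {e} {a} {k} t 1+n≡p^e 1+l≡a*p^[[1+k]*e] 1≤a a<p 1≤t t≤e =
      trans (cong (excess t +_) tail) (excess+⌊l/p^t⌋≡l t (subst (p ^ t ∣_) (sym 1+n≡p^e) (b^m∣b^n p t≤e)))
      where
      open ≡-Reasoning
      K = p ^ (k * e)
      c = a * p ^ (e ∸ t)
      1≤c : 1 ≤ c
      1≤c = *-mono-≤ 1≤a (m^n>0 p (e ∸ t))
      p^e≡p^t*p^[e∸t] : p ^ e ≡ p ^ t * p ^ (e ∸ t)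
      p^e≡p^t*p^[e∸t] = trans (cong (p ^_) (sym (m+[n∸m]≡n t≤e))) (^-distribˡ-+-* p t (e ∸ t))
      c≤p^e : c ≤ p ^ e
      c≤p^e = ≤-trans (*-monoˡ-≤ (p ^ (e ∸ t)) (≤-trans (<⇒≤ a<p) (≤-trans (≤-reflexive (sym (*-identityʳ p))) (^-monoʳ-≤ p 1≤t))))
                      (≤-reflexive (sym p^e≡p^t*p^[e∸t]))
      1+l≡p^t*[c*K] : suc l ≡ p ^ t * (c * K)
      1+l≡p^t*[c*K] = begin
        suc l                                   ≡⟨ 1+l≡a*p^[[1+k]*e] ⟩
        a * p ^ (e + k * e)                     ≡⟨ cong (a *_) (trans (^-distribˡ-+-* p e (k * e)) (cong (_* K) p^e≡p^t*p^[e∸t])) ⟩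
        a * (p ^ t * p ^ (e ∸ t) * K)           ≡⟨ shuffle a (p ^ t) (p ^ (e ∸ t)) K ⟩
        p ^ t * (c * K)                         ∎
        where
        shuffle : ∀ a x y z → a * (x * y * z) ≡ x * (a * y * z)
        shuffle = solve-∀
      term : ∀ j → 1 ≤ j → excess (j * e + t) ≡ ⌊ c * K * n /p^ (j * e) ⌋
      term j@(suc j') _ = begin
        excess (j * e + t)                      ≡⟨ excess-large (j * e + t) n<p^[j*e+t] ⟩
        ⌊ suc l * n /p^ (j * e + t) ⌋           ≡⟨ ⌊⌊m/p^s⌋/p^t⌋≡⌊m/p^[t+s]⌋ (suc l * n) t (j * e) ⟨
        ⌊ ⌊ suc l * n /p^ t ⌋ /p^ (j * e) ⌋     ≡⟨ cong (λ m → ⌊ ⌊ m /p^ t ⌋ /p^ (j * e) ⌋) [1+l]*n≡p^t*[c*K*n] ⟩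
        ⌊ ⌊ p ^ t * (c * K * n) /p^ t ⌋ /p^ (j * e) ⌋  ≡⟨ cong ⌊_/p^ (j * e) ⌋ (⌊p^t*m/p^t⌋≡m t (c * K * n)) ⟩
        ⌊ c * K * n /p^ (j * e) ⌋               ∎
        where
        n<p^[j*e+t] : n < p ^ (j * e + t)
        n<p^[j*e+t] = <-≤-trans (≤-reflexive 1+n≡p^e) (^-monoʳ-≤ p (≤-trans (m≤m+n e (j' * e)) (m≤m+n (j * e) t)))
        [1+l]*n≡p^t*[c*K*n] : suc l * n ≡ p ^ t * (c * K * n)
        [1+l]*n≡p^t*[c*K*n] = trans (cong (_* n) 1+l≡p^t*[c*K]) (*-assoc (p ^ t) (c * K) n)
      tail : ∑ (λ j → excess (j * e + t)) 1 (suc k) ≡ ⌊ l /p^ t ⌋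
      tail = suc-injective (begin
        suc (∑ (λ j → excess (j * e + t)) 1 (suc k))           ≡⟨ cong suc (∑-cong 1 (suc k) (λ j 1≤j _ → term j 1≤j)) ⟩
        suc (∑ (λ j → ⌊ c * K * n /p^ (j * e) ⌋) 1 (suc k))    ≡⟨ geometricFloorSum 1+n≡p^e 1≤c c≤p^e k ⟩
        c * K                                                  ≡⟨ suc[m/d]≡w {{p^≢0 t}} ≤-refl (m^n>0 p t) (trans (+-comm l 1) 1+l≡p^t*[c*K]) ⟨
        suc ⌊ l /p^ t ⌋                                        ∎)

    gap-special : ∀ {e a k B} → suc n ≡ p ^ e → suc l ≡ a * p ^ (suc k * e) → 1 ≤ a → a < p →
                  suc (suc k) * e ≤ B → e * l ≤ ∑ excess 1 B
    gap-special {e} {a} {k} {B} 1+n≡p^e 1+l≡a*p^[[1+k]*e] 1≤a a<p bound = begin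
      e * l                                                        ≡⟨ ∑-const l 1 e ⟨
      ∑ (λ _ → l) 1 e                                              ≡⟨ ∑-cong 1 e (λ t 1≤t t<1+e → sym (column t 1≤t (≤-pred t<1+e))) ⟩
      ∑ (λ t → ∑ (λ j → excess (j * e + t)) 0 (suc (suc k))) 1 e   ≡⟨ ∑-columns excess e (suc (suc k)) ⟨
      ∑ excess 1 (suc (suc k) * e)                                 ≤⟨ ∑-monoʳ-≤ excess 1 bound ⟩
      ∑ excess 1 B                                                 ∎
      where
      open ≤-Reasoning
      column : ∀ t → 1 ≤ t → t ≤ e → ∑ (λ j → excess (j * e + t)) 0 (suc (suc k)) ≡ l
      column t = columnSum-special {k = k} t 1+n≡p^e 1+l≡a*p^[[1+k]*e] 1≤a a<p

    -- Large enough for Legendre's formula at (l + 1) n and for every index used in the gap lemmas.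
    bound : ℕ
    bound = suc l * suc n * suc n

    [1+n]*[1+n]≤bound : suc n * suc n ≤ bound
    [1+n]*[1+n]≤bound = subst (suc n * suc n ≤_) (sym (*-assoc (suc l) (suc n) (suc n))) (m≤n*m (suc n * suc n) (suc l))

    [1+n]*[1+l]≤bound : suc n * suc l ≤ bound
    [1+n]*[1+l]≤bound = ≤-trans (≤-reflexive (*-comm (suc n) (suc l))) (m≤m*n (suc l * suc n) (suc n))

    ≤bound : ∀ x → p ^ x ≤ bound → x ≤ bound
    ≤bound x = ≤-trans (<⇒≤ (n<p^n x))

    gap⇒p^E∣numerator : ∀ {e m} → suc n ≡ p ^ e * m → ¬ p ∣ m → e * l ≤ ∑ excess 1 bound →
                        ∀ E → p ^ E ∣ suc n ^ l * (n !) ^ suc l → p ^ E ∣ (suc l * n) !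
    gap⇒p^E∣numerator {e} {m} 1+n≡p^e*m p∤m gap E p^E∣denominator
      with legendre n (≤-trans (n≤1+n n) (≤-trans (m≤m*n (suc n) (suc n)) [1+n]*[1+n]≤bound))
         | legendre (suc l * n) (≤-trans (*-monoʳ-≤ (suc l) (n≤1+n n)) (m≤m*n (suc l * suc n) (suc n)))
    ... | u , n!≡p^v*u , p∤u | u' , [[1+l]*n]!≡p^w*u' , _ =
      subst (p ^ E ∣_) (sym [[1+l]*n]!≡p^w*u') (∣-trans (b^m∣b^n p E≤w) (m∣m*n u'))
      where
      v = legendreSum bound n
      denominator≡ : suc n ^ l * (n !) ^ suc l ≡ p ^ (e * l + v * suc l) * (m ^ l * u ^ suc l)
      denominator≡ = begin
        suc n ^ l * (n !) ^ suc l                              ≡⟨ cong₂ (λ x y → x ^ l * y ^ suc l) 1+n≡p^e*m n!≡p^v*u ⟩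
        (p ^ e * m) ^ l * (p ^ v * u) ^ suc l                  ≡⟨ cong₂ _*_ ([m*n]^k≡m^k*n^k (p ^ e) m l) ([m*n]^k≡m^k*n^k (p ^ v) u (suc l)) ⟩
        (p ^ e) ^ l * m ^ l * ((p ^ v) ^ suc l * u ^ suc l)    ≡⟨ cong₂ (λ x y → x * m ^ l * (y * u ^ suc l)) (^-*-assoc p e l) (^-*-assoc p v (suc l)) ⟩
        p ^ (e * l) * m ^ l * (p ^ (v * suc l) * u ^ suc l)    ≡⟨ interchange (p ^ (e * l)) (m ^ l) (p ^ (v * suc l)) (u ^ suc l) ⟩
        p ^ (e * l) * p ^ (v * suc l) * (m ^ l * u ^ suc l)    ≡⟨ cong (_* (m ^ l * u ^ suc l)) (^-distribˡ-+-* p (e * l) (v * suc l)) ⟨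
        p ^ (e * l + v * suc l) * (m ^ l * u ^ suc l)          ∎
        where
        open ≡-Reasoning
        interchange : ∀ w x y z → w * x * (y * z) ≡ w * y * (x * z)
        interchange = solve-∀
      E≤w : E ≤ legendreSum bound (suc l * n)
      E≤w = begin
        E                                     ≤⟨ p^e∣p^a*r⇒e≤a E _ (p∤* (p∤^ l p∤m) (p∤^ (suc l) p∤u))
                                                   (subst (p ^ E ∣_) denominator≡ p^E∣denominator) ⟩
        e * l + v * suc l                     ≤⟨ +-monoˡ-≤ (v * suc l) gap ⟩
        ∑ excess 1 bound + v * suc l          ≡⟨ +-comm _ (v * suc l) ⟩
        v * suc l + ∑ excess 1 bound          ≡⟨ cong (_+ ∑ excess 1 bound) (*-comm v (suc l)) ⟩
        suc l * v + ∑ excess 1 bound          ≡⟨ legendreSum-scale bound ⟨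
        legendreSum bound (suc l * n)         ∎
        where open ≤-Reasoning

    ¬gap⇒primePower : ∀ {e m} → suc n ≡ p ^ e * m → ¬ p ∣ m → ¬ e * l ≤ ∑ excess 1 bound → m ≡ 1
    ¬gap⇒primePower {m = 0}      _          p∤0 _    = ⊥-elim (p∤0 (_ ∣0))
    ¬gap⇒primePower {m = 1}      _          _   _    = refl
    ¬gap⇒primePower {e} {m@(2+ _)} 1+n≡p^e*m p∤m ¬gap with strictPowerBracket (s≤s (s≤s z≤n)) p∤m
    ... | s , p^s<m , m<p^[1+s] = ⊥-elim (¬gap (gap-notPrimePower {e} {m} {s} 1+n≡p^e*m p^s<m m<p^[1+s] (≤bound _ (begin
      p ^ ((e + s) + e)          ≡⟨ ^-distribˡ-+-* p (e + s) e ⟩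
      p ^ (e + s) * p ^ e        ≤⟨ *-monoˡ-≤ (p ^ e) p^[e+s]≤1+n ⟩
      suc n * p ^ e              ≤⟨ *-monoʳ-≤ (suc n) (≤-trans (m≤m*n (p ^ e) m) (≤-reflexive (sym 1+n≡p^e*m))) ⟩
      suc n * suc n              ≤⟨ [1+n]*[1+n]≤bound ⟩
      bound                      ∎))))
      where
      open ≤-Reasoning
      p^[e+s]≤1+n : p ^ (e + s) ≤ suc n
      p^[e+s]≤1+n = begin
        p ^ (e + s)          ≡⟨ ^-distribˡ-+-* p e s ⟩
        p ^ e * p ^ s        ≤⟨ *-monoʳ-≤ (p ^ e) (<⇒≤ p^s<m) ⟩
        p ^ e * m            ≡⟨ 1+n≡p^e*m ⟨
        suc n                ∎

    ¬gap⇒exceptional : ∀ {e} → suc n ≡ p ^ e → ¬ e * l ≤ ∑ excess 1 bound → Exceptional l n p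
    ¬gap⇒exceptional {zero}    _      ¬gap = ⊥-elim (¬gap z≤n)
    ¬gap⇒exceptional {e@(suc _)} 1+n≡p^e ¬gap = e , s≤s z≤n , cong (_∸ 1) 1+n≡p^e , p^e≤l , notSpecial
      where
      open ≤-Reasoning
      p^e≤l : p ^ e ≤ l
      p^e≤l with suc l ≤? p ^ e
      ... | no  1+l≰p^e = ≤-pred (≰⇒> 1+l≰p^e)
      ... | yes 1+l≤p^e = ⊥-elim (¬gap (gap-large 1+n≡p^e 1+l≤p^e (≤bound (e + e) (begin
        p ^ (e + e)       ≡⟨ ^-distribˡ-+-* p e e ⟩
        p ^ e * p ^ e     ≡⟨ cong₂ _*_ 1+n≡p^e 1+n≡p^e ⟨
        suc n * suc n     ≤⟨ [1+n]*[1+n]≤bound ⟩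
        bound             ∎))))
      notSpecial : (k a : ℕ) → 1 ≤ k → 1 ≤ a → a + 1 ≤ p → l ≢ a * p ^ (k * e) ∸ 1
      notSpecial (suc k) a _ 1≤a a+1≤p l≡a*p^[k*e]∸1 =
        ¬gap (gap-special {e} {a} {k} 1+n≡p^e 1+l≡a*p^[k*e] 1≤a (≤-trans (≤-reflexive (+-comm 1 a)) a+1≤p) (≤bound _ (begin
          p ^ (e + suc k * e)            ≡⟨ ^-distribˡ-+-* p e (suc k * e) ⟩
          p ^ e * p ^ (suc k * e)        ≤⟨ *-monoʳ-≤ (p ^ e) (m≤n*m (p ^ (suc k * e)) a {{≢-nonZero (λ a≡0 → <⇒≢ 1≤a (sym a≡0))}}) ⟩
          p ^ e * (a * p ^ (suc k * e))  ≡⟨ cong₂ _*_ 1+n≡p^e 1+l≡a*p^[k*e] ⟨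
          suc n * suc l                  ≤⟨ [1+n]*[1+l]≤bound ⟩
          bound                          ∎)))
        where
        1+l≡a*p^[k*e] : suc l ≡ a * p ^ (suc k * e)
        1+l≡a*p^[k*e] = trans (cong suc l≡a*p^[k*e]∸1) (trans (+-comm 1 _) (m∸n+n≡m (*-mono-≤ 1≤a (m^n>0 p (suc k * e)))))

    p^E∣denominator⇒p^E∣numerator⊎exceptional :
      (∀ E → p ^ E ∣ suc n ^ l * (n !) ^ suc l → p ^ E ∣ (suc l * n) !) ⊎ Exceptional l n p
    p^E∣denominator⇒p^E∣numerator⊎exceptional with factorOut (suc n)
    ... | e , m , 1+n≡p^e*m , p∤m with e * l ≤? ∑ excess 1 bound
    ...   | yes gap = inj₁ (gap⇒p^E∣numerator {e} 1+n≡p^e*m p∤m gap)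
    ...   | no ¬gap = inj₂ (¬gap⇒exceptional {e} 1+n≡p^e ¬gap)
      where
      1+n≡p^e : suc n ≡ p ^ e
      1+n≡p^e = trans 1+n≡p^e*m (trans (cong (p ^ e *_) (¬gap⇒primePower {e} 1+n≡p^e*m p∤m ¬gap)) (*-identityʳ (p ^ e)))

-- Local-to-global divisibility

primeFactor : ∀ m .{{_ : NonTrivial m}} → ∃[ p ] (Prime p × p ∣ m)
primeFactor m@(2+ _) with factorise m
... | record { factors = [] ; isFactorisation = () }
... | record { factors = p ∷ ps ; isFactorisation = m≡p*Πps ; factorsPrime = p-prime ∷ _ } =
  p , p-prime , divides (product ps) (trans m≡p*Πps (*-comm p _))

-- Constructive form of "m ∣ n as soon as every prime power dividing m divides n".
∣-or-primePowerWitness : ∀ m n .{{_ : NonZero m}} → m ∣ n ⊎ ∃[ p ] ∃[ e ] (Prime p × p ^ e ∣ m × ¬ p ^ e ∣ n)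
∣-or-primePowerWitness m n = <-rec Result go m
  where
  Result : ℕ → Set
  Result m = .{{NonZero m}} → m ∣ n ⊎ ∃[ p ] ∃[ e ] (Prime p × p ^ e ∣ m × ¬ p ^ e ∣ n)
  go : ∀ m → (∀ {k} → k < m → Result k) → Result m
  go 1 _ = inj₁ (1∣ n)
  go m@(suc (suc _)) rec with primeFactor m
  ... | p , p-prime , p∣m with factorOut p-prime m
  ...   | zero  , r , m≡r , p∤r = ⊥-elim (p∤r (subst (p ∣_) (trans m≡r (*-identityˡ r)) p∣m))
  ...   | suc a , r , m≡p^a*r , p∤r with r
  ...     | zero  = ⊥-elim (≢-nonZero⁻¹ m (trans m≡p^a*r (*-zeroʳ (p ^ suc a))))
  ...     | r@(suc _) with rec r<m
    where
    r<m : r < m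
    r<m = subst (r <_) (trans (*-comm r _) (sym m≡p^a*r)) (m<m*n r (p ^ suc a) (^-monoʳ-< p (1<p p-prime) {0} {suc a} z<s))
  ... | inj₂ (q , f , q-prime , q^f∣r , q^f∤n) = inj₂ (q , f , q-prime , ∣-trans q^f∣r (divides (p ^ suc a) m≡p^a*r) , q^f∤n)
  ... | inj₁ (divides y n≡y*r) with p ^ suc a ∣? n
  ...   | no  p^a∤n = inj₂ (p , suc a , p-prime , divides r (trans m≡p^a*r (*-comm _ r)) , p^a∤n)
  ...   | yes p^a∣n = inj₁ (subst₂ _∣_ (sym m≡p^a*r) (sym n≡y*r)
            (*-monoˡ-∣ r (p^e∣m*r⇒p^e∣m p-prime (suc a) y p∤r (subst (p ^ suc a ∣_) n≡y*r p^a∣n))))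

nonInteger⇒exceptionalPrime : ∀ l n → ¬ CIsInteger l n → ∃[ p ] (Prime p × Exceptional l n p)
nonInteger⇒exceptionalPrime l n ¬integer
  with ∣-or-primePowerWitness (suc n ^ l * (n !) ^ suc l) ((suc l * n) !)
         {{m*n≢0 _ _ {{m^n≢0 (suc n) l}} {{m^n≢0 (n !) (suc l) {{n !≢0}}}}}}
... | inj₁ denominator∣numerator =
  ⊥-elim (¬integer (subst₂ (λ a b → a ^ l * (n !) ^ b ∣ (b * n) !) (+-comm 1 n) (+-comm 1 l) denominator∣numerator))
... | inj₂ (p , E , p-prime , p^E∣denominator , p^E∤numerator) with Excess.p^E∣denominator⇒p^E∣numerator⊎exceptional p-prime l n
...   | inj₁ p^E∣numerator = ⊥-elim (p^E∤numerator (p^E∣numerator E p^E∣denominator))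
...   | inj₂ exceptional   = p , p-prime , exceptional

theorem10 : (l : ℕ) → 1 ≤ l →
    (∃[ N ] ((n : ℕ) → 1 ≤ n → ¬ CIsInteger l n → n ≤ N))
    × ((n : ℕ) → 1 ≤ n → ¬ CIsInteger l n →
        ∃[ p ] ∃[ j ] (Prime p × 1 ≤ j × n ≡ p ^ j ∸ 1 × p ^ j ≤ l
          × ((k a : ℕ) → 1 ≤ k → 1 ≤ a → a + 1 ≤ p → l ≢ a * p ^ (k * j) ∸ 1)))
theorem10 l _ = (l , λ n _ ¬integer → n≤l (nonInteger⇒exceptionalPrime l n ¬integer))
              , (λ n _ ¬integer → reorder (nonInteger⇒exceptionalPrime l n ¬integer))
  where
  n≤l : ∀ {n} → ∃[ p ] (Prime p × Exceptional l n p) → n ≤ l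
  n≤l (p , _ , j , _ , n≡p^j∸1 , p^j≤l , _) = ≤-trans (≤-reflexive n≡p^j∸1) (≤-trans (m∸n≤m (p ^ j) 1) p^j≤l)
  reorder : ∀ {n} → ∃[ p ] (Prime p × Exceptional l n p) → ∃[ p ] ∃[ j ] (Prime p × 1 ≤ j × n ≡ p ^ j ∸ 1 × p ^ j ≤ l
              × ((k a : ℕ) → 1 ≤ k → 1 ≤ a → a + 1 ≤ p → l ≢ a * p ^ (k * j) ∸ 1))
  reorder (p , p-prime , j , rest) = p , j , p-prime , rest
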